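{- The coefficient of $q^n$ in the power series expansion of \[ (1-q)(1-q^5)(-1+q^2+q^3+q^4-q^5)(-q;q)_\infty \] is nonnegative for every $n\geq 1$.
   Context: $(a;q)_\infty=\prod_{j\geq 0}(1-aq^j)$, so $(-q;q)_\infty=\prod_{j\geq1}(1+q^j)$. -}

module Defs where

open import Data.Nat using (ℕ; zero; suc)
open import Data.Integer using (ℤ; +_; -[1+_]; _+_; _*_)
open import Data.List using (List; []; _∷_; replicate; _++_)

-- Polynomials over ℤ as coefficient lists, lowest degree first:
-- a₀ ∷ a₁ ∷ … represents a₀ + a₁ q + a₂ q² + …
Poly : Set
Poly = List ℤ

coeff : Poly → ℕ → ℤ
coeff []       _       = + 0
coeff (a ∷ p)  zero    = a
coeff (a ∷ p)  (suc n) = coeff p n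

_⊕_ : Poly → Poly → Poly
[]      ⊕ q       = q
(a ∷ p) ⊕ []      = a ∷ p
(a ∷ p) ⊕ (b ∷ q) = (a + b) ∷ (p ⊕ q)

scale : ℤ → Poly → Poly
scale c []      = []
scale c (a ∷ p) = (c * a) ∷ scale c p

_⊗_ : Poly → Poly → Poly
[]      ⊗ q = []
(a ∷ p) ⊗ q = scale a q ⊕ (+ 0 ∷ (p ⊗ q))

onePlusQ^ : ℕ → Poly
onePlusQ^ j = (+ 1 ∷ replicate j (+ 0)) ⊕ (replicate j (+ 0) ++ (+ 1 ∷ []))

prodDistinct : ℕ → Poly
prodDistinct zero    = + 1 ∷ []
prodDistinct (suc m) = prodDistinct m ⊗ onePlusQ^ (suc m)

-- Coefficient of q^n in (-q;q)_∞ = ∏_{j≥1}(1+q^j).  Factors with j > n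
-- do not affect the coefficient of q^n, so it equals the coefficient of
-- q^n in the finite product ∏_{j=1}^{n}(1+q^j).
coeffMinusQ∞ : ℕ → ℤ
coeffMinusQ∞ n = coeff (prodDistinct n) n

-1ℤ : ℤ
-1ℤ = -[1+ 0 ]

P : Poly
P = ((+ 1 ∷ -1ℤ ∷ [])
      ⊗ (+ 1 ∷ + 0 ∷ + 0 ∷ + 0 ∷ + 0 ∷ -1ℤ ∷ []))
      ⊗ (-1ℤ ∷ + 0 ∷ + 1 ∷ + 1 ∷ + 1 ∷ -1ℤ ∷ [])

sumTo : ℕ → (ℕ → ℤ) → ℤ
sumTo zero    f = f zero
sumTo (suc n) f = sumTo n f + f (suc n)

coeffSeries : ℕ → ℤ
coeffSeries n = sumTo n (λ k → coeff P k * coeffMinusQ∞ (n Data.Nat.∸ k))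

-- By Euler's identity (-q;q)_∞ = 1/(q;q²)_∞ the factors 1 - q and 1 - q⁵ cancel, and the
-- series is (-1 + q² + q³ + q⁴ - q⁵)·o with T = 1/(q⁷;q²)_∞ and o = T/(1 - q³).  Since
-- -1 + q² + q³ + q⁴ - q⁵ = (q² - 1)(1 - q³) + q⁴, this is q²T - T + q⁴o.  Now T = B + q⁷T with
-- B = 1/(q⁹;q²)_∞, and coefficientwise B ≤ 1 + q²T while q⁷T ≤ q⁴o (as q³T ≤ o), so every
-- coefficient of positive degree is nonnegative.  All of this is carried out on truncations:
-- up to degree N, (-q;q)_∞ is (-q;q)_N, and Euler's identity follows from
-- (q;q)_N (-q;q)_N = (q²;q²)_N together with (q;q)_2N = (q;q²)_N (q²;q²)_N ≡ (q;q)_N.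

module Submission where

open import Defs
open import Data.Integer.Base using (ℤ; +_; _+_; _*_; -_; _-_; _≤_; +≤+)
open import Data.Integer.Properties
  using ( +-assoc; +-identityˡ; +-identityʳ; *-identityˡ; *-identityʳ; *-zeroʳ; -1*i≡-i
        ; ≤-refl; ≤-trans; +-mono-≤; +-monoʳ-≤; +-monoˡ-≤; i≤j⇒0≤j-i; module ≤-Reasoning)
open import Data.Integer.Tactic.RingSolver using (solve-∀)
open import Data.List.Base using (List; []; _∷_; replicate; _++_)
open import Data.Nat.Base as ℕ using (ℕ; zero; suc; pred; _∸_; _≥_; z≤n; s≤s)
import Data.Nat.Properties as ℕ
import Data.Nat.Tactic.RingSolver as ℕ-Solver
open import Data.Nat.Induction using (<-rec)
open import Relation.Binary.PropositionalEquality
open import Relation.Binary.Bundles using (Setoid)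
import Relation.Binary.Reasoning.Setoid as SetoidReasoning

-- Formal power series over ℤ

Series : Set
Series = ℕ → ℤ

0ˢ : Series
0ˢ _ = + 0

1ˢ : Series
1ˢ zero    = + 1
1ˢ (suc _) = + 0

infixl 6 _+ˢ_
infixr 7 _·ˢ_
infix  8 -ˢ_
infix  4 _≤ˢ_ _≈[≤_]_

_+ˢ_ : Series → Series → Series
(f +ˢ g) n = f n + g n

-ˢ_ : Series → Series
(-ˢ f) n = - f n

_·ˢ_ : ℤ → Series → Series
(a ·ˢ f) n = a * f n

_≤ˢ_ : Series → Series → Set
f ≤ˢ g = ∀ n → f n ≤ g n

_≈[≤_]_ : Series → ℕ → Series → Set
f ≈[≤ N ] g = ∀ n → n ℕ.≤ N → f n ≡ g n

1ˢ-nonneg : 0ˢ ≤ˢ 1ˢ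
1ˢ-nonneg zero    = +≤+ z≤n
1ˢ-nonneg (suc n) = ≤-refl

≤-+-nonnegʳ : ∀ i {j} → + 0 ≤ j → i ≤ i + j
≤-+-nonnegʳ i {j} j≥0 = subst (_≤ i + j) (+-identityʳ i) (+-monoʳ-≤ i j≥0)

≤-+-nonnegˡ : ∀ i {j} → + 0 ≤ j → i ≤ j + i
≤-+-nonnegˡ i {j} j≥0 = subst (_≤ j + i) (+-identityˡ i) (+-monoˡ-≤ i j≥0)

shift : ℕ → Series → Series
shift zero    f n       = f n
shift (suc j) f zero    = + 0
shift (suc j) f (suc n) = shift j f n

module _ (R : ℤ → ℤ → Set) (R-0 : R (+ 0) (+ 0)) where

  shift-preserves : ∀ j {f g} n → (∀ m → m ℕ.≤ n → R (f m) (g m)) →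
                    R (shift j f n) (shift j g n)
  shift-preserves zero    n       r = r n ℕ.≤-refl
  shift-preserves (suc j) zero    r = R-0
  shift-preserves (suc j) (suc n) r = shift-preserves j n (λ m m≤n → r m (ℕ.m≤n⇒m≤1+n m≤n))

  shift-suc-preserves : ∀ a {f g} n → (∀ m → m ℕ.< n → R (f m) (g m)) →
                        R (shift (suc a) f n) (shift (suc a) g n)
  shift-suc-preserves a zero    r = R-0
  shift-suc-preserves a (suc n) r = shift-preserves a n (λ m m≤n → r m (s≤s m≤n))

shift-≈ : ∀ j {f g N} → f ≈[≤ N ] g → shift j f ≈[≤ N ] shift j g
shift-≈ j f≈g n n≤N = shift-preserves _≡_ refl j n (λ m m≤n → f≈g m (ℕ.≤-trans m≤n n≤N))

shift-cong : ∀ j {f g} → f ≗ g → shift j f ≗ shift j g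
shift-cong j f≗g n = shift-preserves _≡_ refl j n (λ m _ → f≗g m)

shift-mono : ∀ j {f g} → f ≤ˢ g → shift j f ≤ˢ shift j g
shift-mono j f≤g n = shift-preserves _≤_ ≤-refl j n (λ m _ → f≤g m)

shift-0ˢ : ∀ j → shift j 0ˢ ≗ 0ˢ
shift-0ˢ zero    n       = refl
shift-0ˢ (suc j) zero    = refl
shift-0ˢ (suc j) (suc n) = shift-0ˢ j n

shift-nonneg : ∀ j {f} → 0ˢ ≤ˢ f → 0ˢ ≤ˢ shift j f
shift-nonneg j {f} f≥0 n = subst (_≤ shift j f n) (shift-0ˢ j n) (shift-mono j f≥0 n)

shift-+ : ∀ j f g → shift j (f +ˢ g) ≗ shift j f +ˢ shift j g
shift-+ zero    f g n       = refl
shift-+ (suc j) f g zero    = refl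
shift-+ (suc j) f g (suc n) = shift-+ j f g n

shift-neg : ∀ j f → shift j (-ˢ f) ≗ -ˢ shift j f
shift-neg zero    f n       = refl
shift-neg (suc j) f zero    = refl
shift-neg (suc j) f (suc n) = shift-neg j f n

shift-· : ∀ j a f → shift j (a ·ˢ f) ≗ a ·ˢ shift j f
shift-· zero    a f n       = refl
shift-· (suc j) a f zero    = sym (*-zeroʳ a)
shift-· (suc j) a f (suc n) = shift-· j a f n

shift-shift : ∀ i j f → shift i (shift j f) ≗ shift (i ℕ.+ j) f
shift-shift zero    j f n       = refl
shift-shift (suc i) j f zero    = refl
shift-shift (suc i) j f (suc n) = shift-shift i j f n

shift-comm : ∀ i j f → shift i (shift j f) ≗ shift j (shift i f)
shift-comm i j f n = begin
  shift i (shift j f) n  ≡⟨ shift-shift i j f n ⟩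
  shift (i ℕ.+ j) f n    ≡⟨ cong (λ k → shift k f n) (ℕ.+-comm i j) ⟩
  shift (j ℕ.+ i) f n    ≡⟨ shift-shift j i f n ⟨
  shift j (shift i f) n  ∎
  where open ≡-Reasoning

shift-below : ∀ j f {n} → n ℕ.< j → shift j f n ≡ + 0
shift-below (suc j) f {zero}  _         = refl
shift-below (suc j) f {suc n} (s≤s n<j) = shift-below j f n<j

-- Multiplying and dividing by 1 ± q^j

infixr 7 1-q^_·_ 1+q^_·_ 1/1-q^_·_

1-q^_·_ : ℕ → Series → Series
1-q^ j · f = f +ˢ -ˢ shift j f

1+q^_·_ : ℕ → Series → Series
1+q^ j · f = f +ˢ shift j f

1-q^-below : ∀ j f {n} → n ℕ.< j → (1-q^ j · f) n ≡ f n
1-q^-below j f n<j = trans (cong (λ x → f _ + - x) (shift-below j f n<j)) (+-identityʳ _)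

1+q^-below : ∀ j f {n} → n ℕ.< j → (1+q^ j · f) n ≡ f n
1+q^-below j f n<j = trans (cong (λ x → f _ + x) (shift-below j f n<j)) (+-identityʳ _)

1-q^-1+q^ : ∀ j f → 1-q^ j · 1+q^ j · f ≗ 1-q^ (j ℕ.+ j) · f
1-q^-1+q^ j f n = begin
  (f n + s n) + - shift j (f +ˢ s) n     ≡⟨ cong (λ x → (f n + s n) + - x) (shift-+ j f s n) ⟩
  (f n + s n) + - (s n + shift j s n)    ≡⟨ cancel (f n) (s n) (shift j s n) ⟩
  f n + - shift j s n                    ≡⟨ cong (λ x → f n + - x) (shift-shift j j f n) ⟩
  f n + - shift (j ℕ.+ j) f n            ∎
  where
  open ≡-Reasoning
  s = shift j f
  cancel : ∀ x y z → (x + y) + - (y + z) ≡ x + - z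
  cancel = solve-∀

-- history j f n = h n ∷ h (n ∸ 1) ∷ ⋯ ∷ h 0 for h = 1/1-q^ j · f, so the recurrence
-- h n = f n + h (n ∸ j) reads entry pred j, and coeff returns 0 past the end exactly
-- when q^j · h vanishes.  Only j ≥ 1 is meaningful.
history : ℕ → Series → ℕ → List ℤ
history j f zero    = f zero ∷ []
history j f (suc n) = (f (suc n) + coeff (history j f n) (pred j)) ∷ history j f n

1/1-q^_·_ : ℕ → Series → Series
(1/1-q^ j · f) n = coeff (history j f n) 0

coeff-history : ∀ j f i n → coeff (history j f n) i ≡ shift i (1/1-q^ j · f) n
coeff-history j f zero    zero    = refl
coeff-history j f zero    (suc n) = refl
coeff-history j f (suc i) zero    = refl
coeff-history j f (suc i) (suc n) = coeff-history j f i n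

1/1-q^-unfold : ∀ a f → 1/1-q^ suc a · f ≗ f +ˢ shift (suc a) (1/1-q^ suc a · f)
1/1-q^-unfold a f zero    = sym (+-identityʳ (f zero))
1/1-q^-unfold a f (suc n) = cong (λ x → f (suc n) + x) (coeff-history (suc a) f a n)

recurrence-≈ : ∀ a {f g h k N} →
               h ≗ f +ˢ shift (suc a) h → k ≗ g +ˢ shift (suc a) k →
               f ≈[≤ N ] g → h ≈[≤ N ] k
recurrence-≈ a {f} {g} {h} {k} {N} h-rec k-rec f≈g = <-rec (λ n → n ℕ.≤ N → h n ≡ k n) step
  where
  step : ∀ n → (∀ {m} → m ℕ.< n → m ℕ.≤ N → h m ≡ k m) → n ℕ.≤ N → h n ≡ k n
  step n ih n≤N = begin
    h n                      ≡⟨ h-rec n ⟩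
    f n + shift (suc a) h n  ≡⟨ cong₂ _+_ (f≈g n n≤N) (shift-suc-preserves _≡_ refl a n earlier) ⟩
    g n + shift (suc a) k n  ≡⟨ k-rec n ⟨
    k n                      ∎
    where
    open ≡-Reasoning
    earlier : ∀ m → m ℕ.< n → h m ≡ k m
    earlier m m<n = ih m<n (ℕ.≤-trans (ℕ.<⇒≤ m<n) n≤N)

1/1-q^-≈ : ∀ a {f g N} → f ≈[≤ N ] g → 1/1-q^ suc a · f ≈[≤ N ] 1/1-q^ suc a · g
1/1-q^-≈ a {f} {g} = recurrence-≈ a (1/1-q^-unfold a f) (1/1-q^-unfold a g)

1/1-q^-cong : ∀ a {f g} → f ≗ g → 1/1-q^ suc a · f ≗ 1/1-q^ suc a · g
1/1-q^-cong a f≗g n = 1/1-q^-≈ a (λ m _ → f≗g m) n ℕ.≤-refl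

1/1-q^-unique : ∀ a {f h} → h ≗ f +ˢ shift (suc a) h → h ≗ 1/1-q^ suc a · f
1/1-q^-unique a {f} h-rec n = recurrence-≈ a {f} {f} h-rec (1/1-q^-unfold a f) (λ _ _ → refl) n ℕ.≤-refl

1-q^-1/1-q^ : ∀ a f → 1-q^ suc a · 1/1-q^ suc a · f ≗ f
1-q^-1/1-q^ a f n = trans (cong (_+ - s n) (1/1-q^-unfold a f n)) (cancel (f n) (s n))
  where
  s = shift (suc a) (1/1-q^ suc a · f)
  cancel : ∀ x y → (x + y) + - y ≡ x
  cancel = solve-∀

1/1-q^-1-q^ : ∀ a f → 1/1-q^ suc a · 1-q^ suc a · f ≗ f
1/1-q^-1-q^ a f n = sym (1/1-q^-unique a {1-q^ suc a · f} (λ m → cancel (f m) (shift (suc a) f m)) n)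
  where
  cancel : ∀ x y → x ≡ (x + - y) + y
  cancel = solve-∀

1/1-q^-nonneg : ∀ a {f} → 0ˢ ≤ˢ f → 0ˢ ≤ˢ 1/1-q^ suc a · f
1/1-q^-nonneg a {f} f≥0 = <-rec (λ n → + 0 ≤ h n) step
  where
  h = 1/1-q^ suc a · f
  step : ∀ n → (∀ {m} → m ℕ.< n → + 0 ≤ h m) → + 0 ≤ h n
  step n ih = subst (+ 0 ≤_) (sym (1/1-q^-unfold a f n))
    (+-mono-≤ (f≥0 n) (subst (_≤ shift (suc a) h n) (shift-0ˢ (suc a) n)
                        (shift-suc-preserves _≤_ ≤-refl a n (λ m m<n → ih m<n))))

1/1-q^-≥ : ∀ a {f} → 0ˢ ≤ˢ f → f ≤ˢ 1/1-q^ suc a · f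
1/1-q^-≥ a {f} f≥0 n = subst (f n ≤_) (sym (1/1-q^-unfold a f n))
  (≤-+-nonnegʳ (f n) (shift-nonneg (suc a) (1/1-q^-nonneg a f≥0) n))

shift-≤-1/1-q^ : ∀ a {f} → 0ˢ ≤ˢ f → shift (suc a) (1/1-q^ suc a · f) ≤ˢ 1/1-q^ suc a · f
shift-≤-1/1-q^ a {f} f≥0 n = subst (s n ≤_) (sym (1/1-q^-unfold a f n)) (≤-+-nonnegˡ (s n) (f≥0 n))
  where s = shift (suc a) (1/1-q^ suc a · f)

-- Shift-invariant linear operators

record IsShiftInvariantLinear (L : Series → Series) : Set where
  field
    ≗-cong     : ∀ {f g} → f ≗ g → L f ≗ L g
    +-homo     : ∀ f g → L (f +ˢ g) ≗ L f +ˢ L g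
    neg-homo   : ∀ f → L (-ˢ f) ≗ -ˢ L f
    shift-homo : ∀ j f → L (shift j f) ≗ shift j (L f)

open IsShiftInvariantLinear

module _ {L : Series → Series} (L-sil : IsShiftInvariantLinear L) where

  1-q^-comm : ∀ j f → L (1-q^ j · f) ≗ 1-q^ j · L f
  1-q^-comm j f n = begin
    L (f +ˢ -ˢ shift j f) n        ≡⟨ +-homo L-sil f _ n ⟩
    L f n + L (-ˢ shift j f) n     ≡⟨ cong (λ x → L f n + x) (neg-homo L-sil _ n) ⟩
    L f n + - L (shift j f) n      ≡⟨ cong (λ x → L f n + - x) (shift-homo L-sil j f n) ⟩
    L f n + - shift j (L f) n      ∎
    where open ≡-Reasoning

  1+q^-comm : ∀ j f → L (1+q^ j · f) ≗ 1+q^ j · L f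
  1+q^-comm j f n = trans (+-homo L-sil f _ n) (cong (λ x → L f n + x) (shift-homo L-sil j f n))

  1/1-q^-comm : ∀ a f → L (1/1-q^ suc a · f) ≗ 1/1-q^ suc a · L f
  1/1-q^-comm a f = 1/1-q^-unique a λ n → begin
    L h n                                  ≡⟨ ≗-cong L-sil (1/1-q^-unfold a f) n ⟩
    L (f +ˢ shift (suc a) h) n             ≡⟨ +-homo L-sil f _ n ⟩
    L f n + L (shift (suc a) h) n          ≡⟨ cong (λ x → L f n + x) (shift-homo L-sil (suc a) h n) ⟩
    L f n + shift (suc a) (L h) n          ∎
    where
    open ≡-Reasoning
    h = 1/1-q^ suc a · f

id-sil : IsShiftInvariantLinear (λ f → f)
id-sil = record
  { ≗-cong     = λ f≗g → f≗g
  ; +-homo     = λ _ _ _ → refl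
  ; neg-homo   = λ _ _ → refl
  ; shift-homo = λ _ _ _ → refl
  }

∘-sil : ∀ {L K} → IsShiftInvariantLinear L → IsShiftInvariantLinear K →
        IsShiftInvariantLinear (λ f → L (K f))
∘-sil {L} {K} L-sil K-sil = record
  { ≗-cong     = λ f≗g → ≗-cong L-sil (≗-cong K-sil f≗g)
  ; +-homo     = λ f g n → trans (≗-cong L-sil (+-homo K-sil f g) n) (+-homo L-sil (K f) (K g) n)
  ; neg-homo   = λ f n → trans (≗-cong L-sil (neg-homo K-sil f) n) (neg-homo L-sil (K f) n)
  ; shift-homo = λ j f n → trans (≗-cong L-sil (shift-homo K-sil j f) n) (shift-homo L-sil j (K f) n)
  }

1-q^-sil : ∀ j → IsShiftInvariantLinear (1-q^ j ·_)
1-q^-sil j = record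
  { ≗-cong     = λ f≗g n → cong₂ (λ x y → x + - y) (f≗g n) (shift-cong j f≗g n)
  ; +-homo     = λ f g n → trans (cong (λ x → (f n + g n) + - x) (shift-+ j f g n))
                                 (regroup (f n) (g n) (shift j f n) (shift j g n))
  ; neg-homo   = λ f n → trans (cong (λ x → - f n + - x) (shift-neg j f n))
                               (negate (f n) (shift j f n))
  ; shift-homo = λ i f n → sym (begin
      shift i (f +ˢ -ˢ shift j f) n            ≡⟨ shift-+ i f _ n ⟩
      shift i f n + shift i (-ˢ shift j f) n   ≡⟨ cong (λ x → shift i f n + x) (shift-neg i _ n) ⟩
      shift i f n + - shift i (shift j f) n    ≡⟨ cong (λ x → shift i f n + - x) (shift-comm i j f n) ⟩
      shift i f n + - shift j (shift i f) n    ∎)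
  }
  where
  open ≡-Reasoning
  regroup : ∀ x y u v → (x + y) + - (u + v) ≡ (x + - u) + (y + - v)
  regroup = solve-∀
  negate : ∀ x u → - x + - - u ≡ - (x + - u)
  negate = solve-∀

1-q^-cong : ∀ j {f g} → f ≗ g → 1-q^ j · f ≗ 1-q^ j · g
1-q^-cong j = ≗-cong (1-q^-sil j)

1+q^-cong : ∀ j {f g} → f ≗ g → 1+q^ j · f ≗ 1+q^ j · g
1+q^-cong j f≗g n = cong₂ _+_ (f≗g n) (shift-cong j f≗g n)

-- Multiplication by polynomials

infixr 7 _⊛_
_⊛_ : Poly → Series → Series
[]      ⊛ f = 0ˢ
(a ∷ p) ⊛ f = a ·ˢ f +ˢ shift 1 (p ⊛ f)

sumTo-cong : ∀ n {g h : ℕ → ℤ} → (∀ k → k ℕ.≤ n → g k ≡ h k) → sumTo n g ≡ sumTo n h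
sumTo-cong zero    g≡h = g≡h zero z≤n
sumTo-cong (suc n) g≡h = cong₂ _+_ (sumTo-cong n (λ k k≤n → g≡h k (ℕ.m≤n⇒m≤1+n k≤n)))
                                   (g≡h (suc n) ℕ.≤-refl)

sumTo-suc : ∀ n g → sumTo (suc n) g ≡ g 0 + sumTo n (λ k → g (suc k))
sumTo-suc zero    g = refl
sumTo-suc (suc n) g = trans (cong (_+ g (suc (suc n))) (sumTo-suc n g))
                            (+-assoc (g 0) (sumTo n (λ k → g (suc k))) (g (suc (suc n))))

sumTo-0 : ∀ n → sumTo n (λ _ → + 0) ≡ + 0
sumTo-0 zero    = refl
sumTo-0 (suc n) = cong (_+ + 0) (sumTo-0 n)

sumTo-convolution : ∀ p f n → sumTo n (λ k → coeff p k * f (n ∸ k)) ≡ (p ⊛ f) n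
sumTo-convolution []      f n       = sumTo-0 n
sumTo-convolution (a ∷ p) f zero    = sym (+-identityʳ (a * f 0))
sumTo-convolution (a ∷ p) f (suc n) =
  trans (sumTo-suc n _) (cong (λ x → a * f (suc n) + x) (sumTo-convolution p f n))

⊛-≈ : ∀ p {f g N} → f ≈[≤ N ] g → p ⊛ f ≈[≤ N ] p ⊛ g
⊛-≈ []      f≈g n n≤N = refl
⊛-≈ (a ∷ p) f≈g n n≤N = cong₂ (λ x y → a * x + y) (f≈g n n≤N) (shift-≈ 1 (⊛-≈ p f≈g) n n≤N)

⊛-sil : ∀ p → IsShiftInvariantLinear (p ⊛_)
⊛-sil p = record
  { ≗-cong     = λ f≗g n → ⊛-≈ p (λ m _ → f≗g m) n ℕ.≤-refl
  ; +-homo     = +-homo′ p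
  ; neg-homo   = neg-homo′ p
  ; shift-homo = shift-homo′ p
  }
  where
  open ≡-Reasoning
  +-homo′ : ∀ p f g → p ⊛ (f +ˢ g) ≗ p ⊛ f +ˢ p ⊛ g
  +-homo′ []      f g n = refl
  +-homo′ (a ∷ p) f g n = begin
    a * (f n + g n) + shift 1 (p ⊛ (f +ˢ g)) n              ≡⟨ cong (λ x → a * (f n + g n) + x)
                                                                   (trans (shift-cong 1 (+-homo′ p f g) n) (shift-+ 1 (p ⊛ f) (p ⊛ g) n)) ⟩
    a * (f n + g n) + (shift 1 (p ⊛ f) n + shift 1 (p ⊛ g) n) ≡⟨ regroup a (f n) (g n) _ _ ⟩
    (a * f n + shift 1 (p ⊛ f) n) + (a * g n + shift 1 (p ⊛ g) n) ∎
    where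
    regroup : ∀ a x y u v → a * (x + y) + (u + v) ≡ (a * x + u) + (a * y + v)
    regroup = solve-∀
  neg-homo′ : ∀ p f → p ⊛ (-ˢ f) ≗ -ˢ (p ⊛ f)
  neg-homo′ []      f n = refl
  neg-homo′ (a ∷ p) f n = begin
    a * - f n + shift 1 (p ⊛ (-ˢ f)) n   ≡⟨ cong (λ x → a * - f n + x)
                                               (trans (shift-cong 1 (neg-homo′ p f) n) (shift-neg 1 (p ⊛ f) n)) ⟩
    a * - f n + - shift 1 (p ⊛ f) n      ≡⟨ negate a (f n) _ ⟩
    - (a * f n + shift 1 (p ⊛ f) n)      ∎
    where
    negate : ∀ a x u → a * - x + - u ≡ - (a * x + u)
    negate = solve-∀
  shift-homo′ : ∀ p j f → p ⊛ shift j f ≗ shift j (p ⊛ f)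
  shift-homo′ []      j f n = sym (shift-0ˢ j n)
  shift-homo′ (a ∷ p) j f n = begin
    a * shift j f n + shift 1 (p ⊛ shift j f) n        ≡⟨ cong (λ x → a * shift j f n + x)
                                                            (trans (shift-cong 1 (shift-homo′ p j f) n) (shift-comm 1 j (p ⊛ f) n)) ⟩
    a * shift j f n + shift j (shift 1 (p ⊛ f)) n      ≡⟨ cong (_+ shift j (shift 1 (p ⊛ f)) n) (shift-· j a f n) ⟨
    shift j (a ·ˢ f) n + shift j (shift 1 (p ⊛ f)) n   ≡⟨ shift-+ j (a ·ˢ f) _ n ⟨
    shift j ((a ∷ p) ⊛ f) n                            ∎

⊛-cong : ∀ p {f g} → f ≗ g → p ⊛ f ≗ p ⊛ g
⊛-cong p = ≗-cong (⊛-sil p)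

⊛-⊕ : ∀ p r f → (p ⊕ r) ⊛ f ≗ p ⊛ f +ˢ r ⊛ f
⊛-⊕ []      r       f n = sym (+-identityˡ _)
⊛-⊕ (a ∷ p) []      f n = sym (+-identityʳ _)
⊛-⊕ (a ∷ p) (b ∷ r) f n = begin
  (a + b) * f n + shift 1 ((p ⊕ r) ⊛ f) n                   ≡⟨ cong (λ x → (a + b) * f n + x)
                                                                 (trans (shift-cong 1 (⊛-⊕ p r f) n) (shift-+ 1 (p ⊛ f) (r ⊛ f) n)) ⟩
  (a + b) * f n + (shift 1 (p ⊛ f) n + shift 1 (r ⊛ f) n)   ≡⟨ regroup a b (f n) _ _ ⟩
  (a * f n + shift 1 (p ⊛ f) n) + (b * f n + shift 1 (r ⊛ f) n) ∎
  where
  open ≡-Reasoning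
  regroup : ∀ a b x u v → (a + b) * x + (u + v) ≡ (a * x + u) + (b * x + v)
  regroup = solve-∀

⊛-scale : ∀ c p f → scale c p ⊛ f ≗ c ·ˢ (p ⊛ f)
⊛-scale c []      f n = sym (*-zeroʳ c)
⊛-scale c (a ∷ p) f n = begin
  c * a * f n + shift 1 (scale c p ⊛ f) n   ≡⟨ cong (λ x → c * a * f n + x)
                                                 (trans (shift-cong 1 (⊛-scale c p f) n) (shift-· 1 c (p ⊛ f) n)) ⟩
  c * a * f n + c * shift 1 (p ⊛ f) n       ≡⟨ distribute c a (f n) _ ⟩
  c * (a * f n + shift 1 (p ⊛ f) n)         ∎
  where
  open ≡-Reasoning
  distribute : ∀ c a x u → c * a * x + c * u ≡ c * (a * x + u)
  distribute = solve-∀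

⊛-⊗ : ∀ p r f → (p ⊗ r) ⊛ f ≗ p ⊛ (r ⊛ f)
⊛-⊗ []      r f n = refl
⊛-⊗ (a ∷ p) r f n = begin
  ((scale a r ⊕ (+ 0 ∷ p ⊗ r)) ⊛ f) n                       ≡⟨ ⊛-⊕ (scale a r) _ f n ⟩
  (scale a r ⊛ f) n + (+ 0 * f n + shift 1 ((p ⊗ r) ⊛ f) n)   ≡⟨ cong₂ (λ x y → x + (+ 0 * f n + y))
                                                                    (⊛-scale a r f n) (shift-cong 1 (⊛-⊗ p r f) n) ⟩
  a * (r ⊛ f) n + (+ 0 * f n + shift 1 (p ⊛ (r ⊛ f)) n)      ≡⟨ cong (λ x → a * (r ⊛ f) n + x) (+-identityˡ _) ⟩
  a * (r ⊛ f) n + shift 1 (p ⊛ (r ⊛ f)) n                    ∎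
  where open ≡-Reasoning

⊛-1ˢ : ∀ p → p ⊛ 1ˢ ≗ coeff p
⊛-1ˢ []      n       = refl
⊛-1ˢ (a ∷ p) zero    = trans (+-identityʳ (a * + 1)) (*-identityʳ a)
⊛-1ˢ (a ∷ p) (suc n) = trans (cong (_+ (p ⊛ 1ˢ) n) (*-zeroʳ a)) (trans (+-identityˡ _) (⊛-1ˢ p n))

replicate-0-⊛ : ∀ j f → replicate j (+ 0) ⊛ f ≗ 0ˢ
replicate-0-⊛ zero    f n = refl
replicate-0-⊛ (suc j) f n =
  trans (+-identityˡ _) (trans (shift-cong 1 (replicate-0-⊛ j f) n) (shift-0ˢ 1 n))

replicate-0-++-⊛ : ∀ j r f → (replicate j (+ 0) ++ r) ⊛ f ≗ shift j (r ⊛ f)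
replicate-0-++-⊛ zero    r f n = refl
replicate-0-++-⊛ (suc j) r f n =
  trans (+-identityˡ _) (trans (shift-cong 1 (replicate-0-++-⊛ j r f) n) (shift-shift 1 j (r ⊛ f) n))

singleton-⊛ : ∀ b f → (b ∷ []) ⊛ f ≗ b ·ˢ f
singleton-⊛ b f n = trans (cong (λ x → b * f n + x) (shift-0ˢ 1 n)) (+-identityʳ (b * f n))

binomial : ℤ → ℕ → ℤ → Poly
binomial a j b = (a ∷ replicate j (+ 0)) ⊕ (replicate j (+ 0) ++ b ∷ [])

binomial-⊛ : ∀ a j b f → binomial a j b ⊛ f ≗ a ·ˢ f +ˢ b ·ˢ shift j f
binomial-⊛ a j b f n = begin
  (binomial a j b ⊛ f) n
    ≡⟨ ⊛-⊕ (a ∷ replicate j (+ 0)) (replicate j (+ 0) ++ b ∷ []) f n ⟩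
  (a * f n + shift 1 (replicate j (+ 0) ⊛ f) n) + ((replicate j (+ 0) ++ b ∷ []) ⊛ f) n
    ≡⟨ cong₂ (λ x y → (a * f n + x) + y)
             (trans (shift-cong 1 (replicate-0-⊛ j f) n) (shift-0ˢ 1 n))
             (replicate-0-++-⊛ j (b ∷ []) f n) ⟩
  (a * f n + + 0) + shift j ((b ∷ []) ⊛ f) n
    ≡⟨ cong₂ _+_ (+-identityʳ (a * f n)) (trans (shift-cong j (singleton-⊛ b f) n) (shift-· j b f n)) ⟩
  a * f n + b * shift j f n
    ∎
  where open ≡-Reasoning

1-q^-as-⊛ : ∀ j f → binomial (+ 1) j -1ℤ ⊛ f ≗ 1-q^ j · f
1-q^-as-⊛ j f n = trans (binomial-⊛ (+ 1) j -1ℤ f n) (cong₂ _+_ (*-identityˡ (f n)) (-1*i≡-i (shift j f n)))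

1+q^-as-⊛ : ∀ j f → onePlusQ^ j ⊛ f ≗ 1+q^ j · f
1+q^-as-⊛ j f n = trans (binomial-⊛ (+ 1) j (+ 1) f n) (cong₂ _+_ (*-identityˡ (f n)) (*-identityˡ (shift j f n)))

-- q-Pochhammer products and Euler's identity

≈[≤]-setoid : ℕ → Setoid _ _
≈[≤]-setoid N = record
  { Carrier       = Series
  ; _≈_           = _≈[≤ N ]_
  ; isEquivalence = record
    { refl  = λ _ _ → refl
    ; sym   = λ f≈g n n≤N → sym (f≈g n n≤N)
    ; trans = λ f≈g g≈h n n≤N → trans (f≈g n n≤N) (g≈h n n≤N)
    }
  }

module ≈[≤]-Reasoning (N : ℕ) = SetoidReasoning (≈[≤]-setoid N)

≗⇒≈[≤] : ∀ {f g} N → f ≗ g → f ≈[≤ N ] g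
≗⇒≈[≤] N f≗g n _ = f≗g n


-- poch a d k f = (q^a;q^d)_k · f = ∏_{i<k} (1 - q^(a + d i)) · f
poch : ℕ → ℕ → ℕ → Series → Series
poch a d zero    f = f
poch a d (suc k) f = 1-q^ (a ℕ.+ d ℕ.* k) · poch a d k f

-- poch⁻¹ a d k f = f / (q^a;q^d)_k
poch⁻¹ : ℕ → ℕ → ℕ → Series → Series
poch⁻¹ a d zero    f = f
poch⁻¹ a d (suc k) f = 1/1-q^ a · poch⁻¹ (a ℕ.+ d) d k f

-- negPoch m f = (-q;q)_m · f
negPoch : ℕ → Series → Series
negPoch zero    f = f
negPoch (suc m) f = 1+q^ suc m · negPoch m f

poch-sil : ∀ a d k → IsShiftInvariantLinear (poch a d k)
poch-sil a d zero    = id-sil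
poch-sil a d (suc k) = ∘-sil (1-q^-sil (a ℕ.+ d ℕ.* k)) (poch-sil a d k)

poch⁻¹-≈ : ∀ a d k {f g N} → f ≈[≤ N ] g → poch⁻¹ (suc a) d k f ≈[≤ N ] poch⁻¹ (suc a) d k g
poch⁻¹-≈ a d zero    f≈g = f≈g
poch⁻¹-≈ a d (suc k) f≈g = 1/1-q^-≈ a (poch⁻¹-≈ (a ℕ.+ d) d k f≈g)

poch⁻¹-cong : ∀ a d k {f g} → f ≗ g → poch⁻¹ (suc a) d k f ≗ poch⁻¹ (suc a) d k g
poch⁻¹-cong a d k f≗g n = poch⁻¹-≈ a d k (≗⇒≈[≤] n f≗g) n ℕ.≤-refl

poch⁻¹-comm : ∀ {L} → IsShiftInvariantLinear L →
              ∀ a d k f → L (poch⁻¹ (suc a) d k f) ≗ poch⁻¹ (suc a) d k (L f)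
poch⁻¹-comm L-sil a d zero    f n = refl
poch⁻¹-comm L-sil a d (suc k) f n =
  trans (1/1-q^-comm L-sil a _ n) (1/1-q^-cong a (poch⁻¹-comm L-sil (a ℕ.+ d) d k f) n)

poch⁻¹-peel : ∀ a d k f →
              poch⁻¹ (suc a) d (suc k) f ≗ poch⁻¹ (suc a) d k (1/1-q^ (suc a ℕ.+ d ℕ.* k) · f)
poch⁻¹-peel a d zero    f n =
  cong (λ e → (1/1-q^ e · f) n) (sym (trans (cong (suc a ℕ.+_) (ℕ.*-zeroʳ d)) (ℕ.+-identityʳ (suc a))))
poch⁻¹-peel a d (suc k) f n =
  trans (1/1-q^-cong a (poch⁻¹-peel (a ℕ.+ d) d k f) n)
        (cong (λ e → poch⁻¹ (suc a) d (suc k) (1/1-q^ e · f) n)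
              (cong suc (trans (ℕ.+-assoc a d (d ℕ.* k)) (cong (a ℕ.+_) (sym (ℕ.*-suc d k))))))

poch⁻¹-poch : ∀ a d k f → poch⁻¹ (suc a) d k (poch (suc a) d k f) ≗ f
poch⁻¹-poch a d zero    f n = refl
poch⁻¹-poch a d (suc k) f n = begin
  poch⁻¹ (suc a) d (suc k) (1-q^ e · g) n        ≡⟨ poch⁻¹-peel a d k _ n ⟩
  poch⁻¹ (suc a) d k (1/1-q^ e · 1-q^ e · g) n   ≡⟨ poch⁻¹-cong a d k (1/1-q^-1-q^ (a ℕ.+ d ℕ.* k) g) n ⟩
  poch⁻¹ (suc a) d k g n                         ≡⟨ poch⁻¹-poch a d k f n ⟩
  f n                                            ∎
  where
  open ≡-Reasoning
  e = suc a ℕ.+ d ℕ.* k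
  g = poch (suc a) d k f

poch-negPoch : ∀ k f → poch 1 1 k (negPoch k f) ≗ poch 2 2 k f
poch-negPoch zero    f n = refl
poch-negPoch (suc k) f n = begin
  (1-q^ (1 ℕ.+ 1 ℕ.* k) · poch 1 1 k (1+q^ suc k · negPoch k f)) n
    ≡⟨ cong (λ e → (1-q^ e · poch 1 1 k (1+q^ suc k · negPoch k f)) n) (cong suc (ℕ.*-identityˡ k)) ⟩
  (1-q^ suc k · poch 1 1 k (1+q^ suc k · negPoch k f)) n
    ≡⟨ 1-q^-cong (suc k) (1+q^-comm (poch-sil 1 1 k) (suc k) (negPoch k f)) n ⟩
  (1-q^ suc k · 1+q^ suc k · poch 1 1 k (negPoch k f)) n
    ≡⟨ 1-q^-1+q^ (suc k) (poch 1 1 k (negPoch k f)) n ⟩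
  (1-q^ (suc k ℕ.+ suc k) · poch 1 1 k (negPoch k f)) n
    ≡⟨ cong (λ e → (1-q^ e · poch 1 1 k (negPoch k f)) n) (double k) ⟩
  (1-q^ (2 ℕ.+ 2 ℕ.* k) · poch 1 1 k (negPoch k f)) n
    ≡⟨ 1-q^-cong (2 ℕ.+ 2 ℕ.* k) (poch-negPoch k f) n ⟩
  (1-q^ (2 ℕ.+ 2 ℕ.* k) · poch 2 2 k f) n
    ∎
  where
  open ≡-Reasoning
  double : ∀ k → suc k ℕ.+ suc k ≡ 2 ℕ.+ 2 ℕ.* k
  double = ℕ-Solver.solve-∀

poch-truncate : ∀ j N f → poch 1 1 (j ℕ.+ N) f ≈[≤ N ] poch 1 1 N f
poch-truncate zero    N f n n≤N = refl
poch-truncate (suc j) N f n n≤N =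
  trans (1-q^-below (1 ℕ.+ 1 ℕ.* (j ℕ.+ N)) (poch 1 1 (j ℕ.+ N) f) n<e) (poch-truncate j N f n n≤N)
  where
  n<e : n ℕ.< 1 ℕ.+ 1 ℕ.* (j ℕ.+ N)
  n<e = s≤s (subst (n ℕ.≤_) (sym (ℕ.*-identityˡ (j ℕ.+ N))) (ℕ.≤-trans n≤N (ℕ.m≤n+m N j)))

negPoch-truncate : ∀ j N f → negPoch (j ℕ.+ N) f ≈[≤ N ] negPoch N f
negPoch-truncate zero    N f n n≤N = refl
negPoch-truncate (suc j) N f n n≤N =
  trans (1+q^-below (suc (j ℕ.+ N)) (negPoch (j ℕ.+ N) f) (s≤s (ℕ.≤-trans n≤N (ℕ.m≤n+m N j)))) (negPoch-truncate j N f n n≤N)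

poch-double : ∀ N f → poch 1 1 (2 ℕ.* N) f ≗ poch 1 2 N (poch 2 2 N f)
poch-double zero    f n = refl
poch-double (suc N) f n = begin
  poch 1 1 (2 ℕ.* suc N) f n
    ≡⟨ cong (λ m → poch 1 1 m f n) (ℕ.*-suc 2 N) ⟩
  (1-q^ (1 ℕ.+ 1 ℕ.* suc (2 ℕ.* N)) · 1-q^ (1 ℕ.+ 1 ℕ.* (2 ℕ.* N)) · poch 1 1 (2 ℕ.* N) f) n
    ≡⟨ cong₂ (λ e₂ e₁ → (1-q^ e₂ · 1-q^ e₁ · poch 1 1 (2 ℕ.* N) f) n)
             (cong suc (ℕ.*-identityˡ _)) (cong suc (ℕ.*-identityˡ _)) ⟩
  (1-q^ even · 1-q^ odd · poch 1 1 (2 ℕ.* N) f) n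
    ≡⟨ 1-q^-cong even (1-q^-cong odd (poch-double N f)) n ⟩
  (1-q^ even · 1-q^ odd · poch 1 2 N (poch 2 2 N f)) n
    ≡⟨ 1-q^-comm (1-q^-sil even) odd (poch 1 2 N (poch 2 2 N f)) n ⟩
  (1-q^ odd · 1-q^ even · poch 1 2 N (poch 2 2 N f)) n
    ≡⟨ 1-q^-cong odd (1-q^-comm (poch-sil 1 2 N) even (poch 2 2 N f)) n ⟨
  (1-q^ odd · poch 1 2 N (1-q^ even · poch 2 2 N f)) n
    ∎
  where
  open ≡-Reasoning
  odd  = 1 ℕ.+ 2 ℕ.* N
  even = 2 ℕ.+ 2 ℕ.* N

euler : ∀ N f → negPoch N f ≈[≤ N ] poch⁻¹ 1 2 N f
euler N f = begin
  negPoch N f                                   ≈⟨ ≗⇒≈[≤] N (poch⁻¹-poch 1 2 N (negPoch N f)) ⟨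
  poch⁻¹ 2 2 N (poch 2 2 N (negPoch N f))       ≈⟨ poch⁻¹-≈ 1 2 N even-cancelled ⟩
  poch⁻¹ 2 2 N (poch 2 2 N (poch⁻¹ 1 2 N f))    ≈⟨ ≗⇒≈[≤] N (poch⁻¹-poch 1 2 N (poch⁻¹ 1 2 N f)) ⟩
  poch⁻¹ 1 2 N f                                ∎
  where
  open ≈[≤]-Reasoning N
  odd-even : poch 1 2 N (poch 2 2 N (negPoch N f)) ≈[≤ N ] poch 2 2 N f
  odd-even = begin
    poch 1 2 N (poch 2 2 N (negPoch N f))   ≈⟨ ≗⇒≈[≤] N (poch-double N (negPoch N f)) ⟨
    poch 1 1 (2 ℕ.* N) (negPoch N f)        ≡⟨ cong (λ m → poch 1 1 (N ℕ.+ m) (negPoch N f)) (ℕ.+-identityʳ N) ⟩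
    poch 1 1 (N ℕ.+ N) (negPoch N f)        ≈⟨ poch-truncate N N (negPoch N f) ⟩
    poch 1 1 N (negPoch N f)                ≈⟨ ≗⇒≈[≤] N (poch-negPoch N f) ⟩
    poch 2 2 N f                            ∎
  even-cancelled : poch 2 2 N (negPoch N f) ≈[≤ N ] poch 2 2 N (poch⁻¹ 1 2 N f)
  even-cancelled = begin
    poch 2 2 N (negPoch N f)                                ≈⟨ ≗⇒≈[≤] N (poch⁻¹-poch 0 2 N (poch 2 2 N (negPoch N f))) ⟨
    poch⁻¹ 1 2 N (poch 1 2 N (poch 2 2 N (negPoch N f)))    ≈⟨ poch⁻¹-≈ 0 2 N odd-even ⟩
    poch⁻¹ 1 2 N (poch 2 2 N f)                             ≈⟨ ≗⇒≈[≤] N (poch⁻¹-comm (poch-sil 2 2 N) 0 2 N f) ⟨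
    poch 2 2 N (poch⁻¹ 1 2 N f)                             ∎

coeff-prodDistinct : ∀ m → coeff (prodDistinct m) ≗ negPoch m 1ˢ
coeff-prodDistinct zero    zero    = refl
coeff-prodDistinct zero    (suc n) = refl
coeff-prodDistinct (suc m) n = begin
  coeff (prodDistinct m ⊗ onePlusQ^ (suc m)) n      ≡⟨ ⊛-1ˢ (prodDistinct m ⊗ onePlusQ^ (suc m)) n ⟨
  ((prodDistinct m ⊗ onePlusQ^ (suc m)) ⊛ 1ˢ) n    ≡⟨ ⊛-⊗ (prodDistinct m) (onePlusQ^ (suc m)) 1ˢ n ⟩
  (prodDistinct m ⊛ (onePlusQ^ (suc m) ⊛ 1ˢ)) n    ≡⟨ ⊛-cong (prodDistinct m) (1+q^-as-⊛ (suc m) 1ˢ) n ⟩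
  (prodDistinct m ⊛ (1+q^ suc m · 1ˢ)) n           ≡⟨ 1+q^-comm (⊛-sil (prodDistinct m)) (suc m) 1ˢ n ⟩
  (1+q^ suc m · (prodDistinct m ⊛ 1ˢ)) n           ≡⟨ 1+q^-cong (suc m) (λ k → trans (⊛-1ˢ (prodDistinct m) k)
                                                                                  (coeff-prodDistinct m k)) n ⟩
  (1+q^ suc m · negPoch m 1ˢ) n                    ∎
  where open ≡-Reasoning

coeffMinusQ∞-negPoch : ∀ {K m} → m ℕ.≤ K → coeffMinusQ∞ m ≡ negPoch K 1ˢ m
coeffMinusQ∞-negPoch {K} {m} m≤K = begin
  coeff (prodDistinct m) m      ≡⟨ coeff-prodDistinct m m ⟩
  negPoch m 1ˢ m                ≡⟨ negPoch-truncate (K ∸ m) m 1ˢ m ℕ.≤-refl ⟨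
  negPoch (K ∸ m ℕ.+ m) 1ˢ m    ≡⟨ cong (λ k → negPoch k 1ˢ m) (ℕ.m∸n+n≡m m≤K) ⟩
  negPoch K 1ˢ m                ∎
  where open ≡-Reasoning

coeffSeries-⊛ : ∀ {K} N → N ℕ.≤ K → coeffSeries N ≡ (P ⊛ negPoch K 1ˢ) N
coeffSeries-⊛ {K} N N≤K = trans
  (sumTo-cong N (λ k _ → cong (λ x → coeff P k * x) (coeffMinusQ∞-negPoch (ℕ.≤-trans (ℕ.m∸n≤m N k) N≤K))))
  (sumTo-convolution P (negPoch K 1ˢ) N)

-- Positivity

poch⁻¹-nonneg : ∀ a d k {f} → 0ˢ ≤ˢ f → 0ˢ ≤ˢ poch⁻¹ (suc a) d k f
poch⁻¹-nonneg a d zero    f≥0 = f≥0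
poch⁻¹-nonneg a d (suc k) f≥0 = 1/1-q^-nonneg a (poch⁻¹-nonneg (a ℕ.+ d) d k f≥0)

poch⁻¹-≤-shift : ∀ a d k {f} → 0ˢ ≤ˢ f →
                 poch⁻¹ (suc a ℕ.+ d) d k f ≤ˢ f +ˢ shift d (poch⁻¹ (suc a) d (suc k) f)
poch⁻¹-≤-shift a d zero    {f} f≥0 n =
  ≤-+-nonnegʳ (f n) (shift-nonneg d (poch⁻¹-nonneg a d 1 f≥0) n)
poch⁻¹-≤-shift a d (suc k) {f} f≥0 n = begin
  A n                                            ≡⟨ 1/1-q^-unfold (a ℕ.+ d) C n ⟩
  C n + shift (suc a ℕ.+ d) A n                  ≤⟨ +-mono-≤ (poch⁻¹-≤-shift (a ℕ.+ d) d k f≥0 n)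
                                                             (shift-mono (suc a ℕ.+ d) (1/1-q^-≥ a A≥0) n) ⟩
  (f n + shift d A n) + shift (suc a ℕ.+ d) B n  ≡⟨ regroup ⟨
  f n + shift d B n                              ∎
  where
  open ≤-Reasoning
  C = poch⁻¹ (suc a ℕ.+ d ℕ.+ d) d k f
  A = poch⁻¹ (suc a ℕ.+ d) d (suc k) f
  B = poch⁻¹ (suc a) d (suc (suc k)) f
  A≥0 : 0ˢ ≤ˢ A
  A≥0 = poch⁻¹-nonneg (a ℕ.+ d) d (suc k) f≥0
  regroup : f n + shift d B n ≡ (f n + shift d A n) + shift (suc a ℕ.+ d) B n
  regroup = begin-equality
    f n + shift d B n                                  ≡⟨ cong (λ x → f n + x) (shift-cong d (1/1-q^-unfold a A) n) ⟩
    f n + shift d (A +ˢ shift (suc a) B) n             ≡⟨ cong (λ x → f n + x) (shift-+ d A _ n) ⟩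
    f n + (shift d A n + shift d (shift (suc a) B) n)  ≡⟨ cong (λ x → f n + (shift d A n + x))
                                                               (trans (shift-shift d (suc a) B n)
                                                                      (cong (λ e → shift e B n) (ℕ.+-comm d (suc a)))) ⟩
    f n + (shift d A n + shift (suc a ℕ.+ d) B n)      ≡⟨ +-assoc (f n) _ _ ⟨
    (f n + shift d A n) + shift (suc a ℕ.+ d) B n      ∎

quintic : Poly
quintic = -1ℤ ∷ + 0 ∷ + 1 ∷ + 1 ∷ + 1 ∷ -1ℤ ∷ []

P-factors : P ≡ (binomial (+ 1) 1 -1ℤ ⊗ binomial (+ 1) 5 -1ℤ) ⊗ quintic
P-factors = refl

quintic-split : quintic ≡ (binomial -1ℤ 2 (+ 1) ⊗ binomial (+ 1) 3 -1ℤ) ⊕ (replicate 4 (+ 0) ++ + 1 ∷ [])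
quintic-split = refl

quintic-⊛ : ∀ f n → (quintic ⊛ f) n ≡ (shift 2 (1-q^ 3 · f) n - (1-q^ 3 · f) n) + shift 4 f n
quintic-⊛ f n = begin
  (quintic ⊛ f) n
    ≡⟨ cong (λ p → (p ⊛ f) n) quintic-split ⟩
  (((b₂ ⊗ b₃) ⊕ q⁴) ⊛ f) n
    ≡⟨ ⊛-⊕ (b₂ ⊗ b₃) q⁴ f n ⟩
  ((b₂ ⊗ b₃) ⊛ f) n + (q⁴ ⊛ f) n
    ≡⟨ cong₂ _+_ (trans (⊛-⊗ b₂ b₃ f n) (⊛-cong b₂ (1-q^-as-⊛ 3 f) n))
                 (trans (replicate-0-++-⊛ 4 (+ 1 ∷ []) f n)
                        (shift-cong 4 (λ m → trans (singleton-⊛ (+ 1) f m) (*-identityˡ (f m))) n)) ⟩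
  (b₂ ⊛ g) n + shift 4 f n
    ≡⟨ cong (_+ shift 4 f n) (binomial-⊛ -1ℤ 2 (+ 1) g n) ⟩
  (-1ℤ * g n + + 1 * shift 2 g n) + shift 4 f n
    ≡⟨ cong (_+ shift 4 f n) (swap (g n) (shift 2 g n)) ⟩
  (shift 2 g n - g n) + shift 4 f n
    ∎
  where
  open ≡-Reasoning
  b₂ = binomial -1ℤ 2 (+ 1)
  b₃ = binomial (+ 1) 3 -1ℤ
  q⁴ = replicate 4 (+ 0) ++ + 1 ∷ []
  g  = 1-q^ 3 · f
  swap : ∀ x y → -1ℤ * x + + 1 * y ≡ y - x
  swap = solve-∀

P-⊛ : ∀ f → P ⊛ (1/1-q^ 1 · 1/1-q^ 3 · 1/1-q^ 5 · f) ≗ quintic ⊛ (1/1-q^ 3 · f)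
P-⊛ f n = begin
  (P ⊛ W) n                                ≡⟨ cong (λ p → (p ⊛ W) n) P-factors ⟩
  (((b₁ ⊗ b₅) ⊗ quintic) ⊛ W) n            ≡⟨ ⊛-⊗ (b₁ ⊗ b₅) quintic W n ⟩
  ((b₁ ⊗ b₅) ⊛ (quintic ⊛ W)) n            ≡⟨ ⊛-⊗ b₁ b₅ (quintic ⊛ W) n ⟩
  (b₁ ⊛ (b₅ ⊛ (quintic ⊛ W))) n            ≡⟨ 1-q^-as-⊛ 1 (b₅ ⊛ (quintic ⊛ W)) n ⟩
  (1-q^ 1 · (b₅ ⊛ (quintic ⊛ W))) n        ≡⟨ 1-q^-cong 1 (1-q^-as-⊛ 5 (quintic ⊛ W)) n ⟩
  (1-q^ 1 · 1-q^ 5 · (quintic ⊛ W)) n      ≡⟨ 1-q^-cong 1 (1-q^-comm (⊛-sil quintic) 5 W) n ⟨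
  (1-q^ 1 · (quintic ⊛ (1-q^ 5 · W))) n    ≡⟨ 1-q^-comm (⊛-sil quintic) 1 (1-q^ 5 · W) n ⟨
  (quintic ⊛ (1-q^ 1 · 1-q^ 5 · W)) n      ≡⟨ ⊛-cong quintic cancel n ⟩
  (quintic ⊛ (1/1-q^ 3 · f)) n             ∎
  where
  open ≡-Reasoning
  b₁ = binomial (+ 1) 1 -1ℤ
  b₅ = binomial (+ 1) 5 -1ℤ
  V  = 1/1-q^ 3 · 1/1-q^ 5 · f
  W  = 1/1-q^ 1 · V
  cancel : 1-q^ 1 · 1-q^ 5 · W ≗ 1/1-q^ 3 · f
  cancel m = begin
    (1-q^ 1 · 1-q^ 5 · 1/1-q^ 1 · V) m              ≡⟨ 1-q^-cong 1 (1/1-q^-comm (1-q^-sil 5) 0 V) m ⟩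
    (1-q^ 1 · 1/1-q^ 1 · 1-q^ 5 · V) m              ≡⟨ 1-q^-1/1-q^ 0 (1-q^ 5 · V) m ⟩
    (1-q^ 5 · 1/1-q^ 3 · 1/1-q^ 5 · f) m            ≡⟨ 1/1-q^-comm (1-q^-sil 5) 2 (1/1-q^ 5 · f) m ⟩
    (1/1-q^ 3 · 1-q^ 5 · 1/1-q^ 5 · f) m            ≡⟨ 1/1-q^-cong 2 (1-q^-1/1-q^ 4 f) m ⟩
    (1/1-q^ 3 · f) m                                ∎

0≤[y-x]+z : ∀ x y z → x ≤ y + z → + 0 ≤ (y - x) + z
0≤[y-x]+z x y z x≤y+z = subst (+ 0 ≤_) (regroup x y z) (i≤j⇒0≤j-i x≤y+z)
  where
  regroup : ∀ x y z → (y + z) - x ≡ (y - x) + z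
  regroup = solve-∀

quintic-⊛-nonneg : ∀ k n → + 0 ≤ (quintic ⊛ (1/1-q^ 3 · poch⁻¹ 7 2 (suc k) 1ˢ)) (suc n)
quintic-⊛-nonneg k n = subst (+ 0 ≤_) (sym value) (0≤[y-x]+z (T N) (shift 2 T N) (shift 4 o N) T-bound)
  where
  N = suc n
  B = poch⁻¹ 9 2 k 1ˢ
  T = poch⁻¹ 7 2 (suc k) 1ˢ
  o = 1/1-q^ 3 · T
  T≥0 : 0ˢ ≤ˢ T
  T≥0 = poch⁻¹-nonneg 6 2 (suc k) 1ˢ-nonneg
  shift³T≤o : shift 3 T ≤ˢ o
  shift³T≤o m = ≤-trans (shift-mono 3 (1/1-q^-≥ 2 T≥0) m) (shift-≤-1/1-q^ 2 T≥0 m)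
  value : (quintic ⊛ o) N ≡ (shift 2 T N - T N) + shift 4 o N
  value = trans (quintic-⊛ o N)
                (cong₂ (λ x y → (x - y) + shift 4 o N) (shift-cong 2 (1-q^-1/1-q^ 2 T) N) (1-q^-1/1-q^ 2 T N))
  T-bound : T N ≤ shift 2 T N + shift 4 o N
  T-bound = begin
    T N                                ≡⟨ 1/1-q^-unfold 6 B N ⟩
    B N + shift 7 T N                  ≡⟨ cong (λ x → B N + x) (shift-shift 4 3 T N) ⟨
    B N + shift 4 (shift 3 T) N        ≤⟨ +-mono-≤ (poch⁻¹-≤-shift 6 2 k 1ˢ-nonneg N) (shift-mono 4 shift³T≤o N) ⟩
    (+ 0 + shift 2 T N) + shift 4 o N  ≡⟨ cong (_+ shift 4 o N) (+-identityˡ (shift 2 T N)) ⟩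
    shift 2 T N + shift 4 o N          ∎
    where open ≤-Reasoning

lemma3p2 : (n : ℕ) → n ≥ 1 → + 0 ≤ coeffSeries n
lemma3p2 (suc n) _ = begin
  + 0                                          ≤⟨ quintic-⊛-nonneg n n ⟩
  (quintic ⊛ (1/1-q^ 3 · poch⁻¹ 7 2 N 1ˢ)) N   ≡⟨ P-⊛ (poch⁻¹ 7 2 N 1ˢ) N ⟨
  (P ⊛ poch⁻¹ 1 2 (3 ℕ.+ N) 1ˢ) N             ≡⟨ ⊛-≈ P euler-≤N N ℕ.≤-refl ⟨
  (P ⊛ negPoch (3 ℕ.+ N) 1ˢ) N                 ≡⟨ coeffSeries-⊛ N (ℕ.m≤n+m N 3) ⟨
  coeffSeries N                                ∎
  where
  open ≤-Reasoning
  N = suc n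
  -- Three more factors than degree N requires, so that 1/(1-q), 1/(1-q³), 1/(1-q⁵) all occur.
  euler-≤N : negPoch (3 ℕ.+ N) 1ˢ ≈[≤ N ] poch⁻¹ 1 2 (3 ℕ.+ N) 1ˢ
  euler-≤N m m≤N = euler (3 ℕ.+ N) 1ˢ m (ℕ.≤-trans m≤N (ℕ.m≤n+m N 3))
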